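{- Let $P_8$ be the graph obtained from $K_9$ by deleting the edges of three pairwise vertex-disjoint paths of length 2 (its vertices of degree $6$ are the three middle vertices of these paths). Let $G_8$ be any graph obtained from a copy of $K_5$ by adding pairwise vertex-disjoint copies of $P_8$, where for each copy one edge is added from each of its three vertices of degree $6$ to some vertex of the $K_5$, there are no edges between distinct copies, and enough copies are added so that every vertex of the $K_5$ has degree at least $7$. Then $G_8$ has minimum degree $7$ and has no immersion of $K_8$.
   Context: A graph $H$ is immersed in a graph $G$ if there is an injection $\phi:V(H)\to V(G)$ and an assignment to each edge $uv\in E(H)$ of a path in $G$ between $\phi(u)$ and $\phi(v)$ with paths of distinct edges pairwise edge-disjoint. -}

module Defs where

open import Data.Nat using (ℕ; zero; suc; _≤_)
open import Data.Bool using (Bool; true; false; if_then_else_; _∧_; _∨_; not; T)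
open import Data.Fin using (Fin; _<_) renaming (zero to fz; suc to fs)
open import Data.Fin.Properties using () renaming (_≟_ to _≟F_)
open import Data.List using (List; []; _∷_; _++_; map; allFin; cartesianProduct; length)
open import Data.List.Relation.Unary.Unique.Propositional using (Unique)
open import Data.Product using (_×_; _,_; Σ; ∃)
open import Data.Sum using (_⊎_; inj₁; inj₂)
open import Data.Empty using (⊥)
open import Relation.Nullary using (¬_)
open import Relation.Nullary.Decidable using (⌊_⌋)
open import Relation.Binary.PropositionalEquality using (_≡_; _≢_)

-- Generic finite simple graphs: vertex type V, Boolean adjacency,
-- together with an explicit enumeration of the vertices (for degrees).

count : {V : Set} → (V → Bool) → List V → ℕ
count f [] = 0
count f (x ∷ xs) = if f x then suc (count f xs) else count f xs

degree : {V : Set} → (V → V → Bool) → List V → V → ℕ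
degree adj vs v = count (adj v) vs

data Walk {V : Set} (adj : V → V → Bool) : V → V → List V → Set where
  single : ∀ {x} → Walk adj x x (x ∷ [])
  step   : ∀ {x y z p} → T (adj x y) → Walk adj y z (y ∷ p) →
           Walk adj x z (x ∷ y ∷ p)

IsPath : {V : Set} → (V → V → Bool) → V → V → List V → Set
IsPath adj x y p = Walk adj x y p × Unique p

data Consec {V : Set} (x y : V) : List V → Set where
  here  : ∀ {p} → Consec x y (x ∷ y ∷ p)
  there : ∀ {z p} → Consec x y p → Consec x y (z ∷ p)

UsesEdge : {V : Set} → V → V → List V → Set
UsesEdge x y p = Consec x y p ⊎ Consec y x p

record ImmersionK (t : ℕ) {V : Set} (adj : V → V → Bool) : Set where
  field
    φ        : Fin t → V
    φ-inj    : ∀ i j → φ i ≡ φ j → i ≡ j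
    path     : Fin t → Fin t → List V
    isPath   : ∀ i j → i < j → IsPath adj (φ i) (φ j) (path i j)
    disjoint : ∀ i j k l → i < j → k < l → ¬ (i ≡ k × j ≡ l) →
               ∀ x y → UsesEdge x y (path i j) → UsesEdge x y (path k l) → ⊥

-- P₈ : K₉ on Fin 9 minus the edges of the paths 0-1-2, 3-4-5, 6-7-8.
-- Its degree-6 vertices are the middle vertices 1, 4, 7.

eqF : ∀ {n} → Fin n → Fin n → Bool
eqF i j = ⌊ i ≟F j ⌋

toN : ∀ {n} → Fin n → ℕ
toN = Data.Fin.toℕ

deletedℕ : ℕ → ℕ → Bool
deletedℕ 0 1 = true
deletedℕ 1 2 = true
deletedℕ 3 4 = true
deletedℕ 4 5 = true
deletedℕ 6 7 = true
deletedℕ 7 8 = true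
deletedℕ _ _ = false

P8adj : Fin 9 → Fin 9 → Bool
P8adj i j = not (eqF i j) ∧ not (deletedℕ (toN i) (toN j)) ∧ not (deletedℕ (toN j) (toN i))

middle : Fin 3 → Fin 9
middle fz = fs fz
middle (fs fz) = fs (fs (fs (fs fz)))
middle (fs (fs fz)) = fs (fs (fs (fs (fs (fs (fs fz))))))

-- G₈(k, a): a K₅ on Fin 5 together with k disjoint copies of P₈
-- (copy c has vertices (c , i), i : Fin 9); the j-th middle vertex of
-- copy c is joined to the K₅-vertex a c j.  No other edges.

G8V : ℕ → Set
G8V k = Fin 5 ⊎ (Fin k × Fin 9)

attached : (k : ℕ) → (Fin k → Fin 3 → Fin 5) → Fin k → Fin 9 → Fin 5 → Bool
attached k a c i x =
     (eqF (middle fz) i ∧ eqF (a c fz) x)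
  ∨ ((eqF (middle (fs fz)) i ∧ eqF (a c (fs fz)) x)
  ∨  (eqF (middle (fs (fs fz))) i ∧ eqF (a c (fs (fs fz))) x))

G8adj : (k : ℕ) → (Fin k → Fin 3 → Fin 5) → G8V k → G8V k → Bool
G8adj k a (inj₁ x) (inj₁ y) = not (eqF x y)
G8adj k a (inj₁ x) (inj₂ (c , i)) = attached k a c i x
G8adj k a (inj₂ (c , i)) (inj₁ x) = attached k a c i x
G8adj k a (inj₂ (c , i)) (inj₂ (d , j)) = eqF c d ∧ P8adj i j

G8vertices : (k : ℕ) → List (G8V k)
G8vertices k = map inj₁ (allFin 5) ++ map inj₂ (cartesianProduct (allFin k) (allFin 9))

G8degree : (k : ℕ) → (Fin k → Fin 3 → Fin 5) → G8V k → ℕ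
G8degree k a = degree (G8adj k a) (G8vertices k)

-- Counting over the vertex enumeration, every vertex of a copy of P₈ has degree
-- exactly 7 in G₈: degree 7 inside P₈, or degree 6 plus its attachment edge for the three
-- middle vertices.  The K₅ vertices have degree ≥ 7 by hypothesis, which forces k ≥ 1.
--
-- In G₈ some branch vertex lies in a copy of P₈, since the K₅ is too small.  If that copy
-- misses a branch vertex, its three attachment edges form a cut and cut-bound gives 7 ≤ 3.
-- Otherwise exactly one vertex W of the copy is free; every branch vertex has degree 7, so
-- the route between two branch vertices non-adjacent in P₈ must pass through W, and the
-- four deleted edges of P₈ avoiding W give degree W ≥ 8 by through-bound.

module Submission where

open import Defs
open import Data.Nat using (ℕ; zero; suc; _+_; _*_; _≤_; s≤s)
open import Data.Nat.Properties using (≤-reflexive; ≤-trans; n≮n; +-identityʳ)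
open import Data.Bool using (Bool; true; false; if_then_else_; _∧_; _∨_; not; T)
open import Data.Bool.Properties using (∨-identityʳ; T-∧; ¬-not) renaming (_≟_ to _≟B_)
open import Data.Fin using (Fin; _<_; #_; punchIn; splitAt; join; quotient) renaming (zero to fz; suc to fs)
open import Data.Fin.Properties using (<-cmp; <⇒≢; punchIn-injective; punchInᵢ≢i; punchOut-injective; injective⇒≤; all?; any?; ¬∀⟶∃¬; join-splitAt) renaming (_≟_ to _≟F_)
open import Data.List using (List; []; _∷_; _++_; map; allFin; tabulate; cartesianProduct; length; lookup; filter)
open import Data.List.Membership.Propositional using (_∈_)
open import Data.List.Membership.Propositional.Properties using (∈-filter⁺; ∈-map⁺; ∈-++⁺ˡ; ∈-++⁺ʳ; ∈-allFin; ∈-cartesianProduct⁺)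
open import Data.List.Relation.Unary.Any using (here; there; index)
open import Data.List.Relation.Unary.Any.Properties using (lookup-index)
open import Data.List.Relation.Unary.All as All using ()
open import Data.List.Relation.Unary.AllPairs using (_∷_)
open import Data.List.Relation.Unary.Unique.Propositional using (Unique)
open import Data.Product using (_×_; Σ; ∃; _,_; proj₁; proj₂)
open import Data.Sum using (_⊎_; inj₁; inj₂) renaming (swap to swap⊎)
open import Data.Empty using (⊥; ⊥-elim)
open import Function using (_∘_)
open import Function.Definitions using (Injective)
open import Function.Bundles using (Equivalence)
open import Data.Vec as Vec using (Vec)
open import Relation.Nullary using (¬_; Dec; yes; no; contradiction)
open import Relation.Nullary.Decidable using (T?; ¬?; _×-dec_; _⊎-dec_; _→-dec_; from-yes)
open import Relation.Binary.Definitions using (tri<; tri≈; tri>)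
open import Relation.Binary.PropositionalEquality using (_≡_; _≢_; refl; sym; trans; cong; cong₂; subst; subst₂; module ≡-Reasoning)

open ≡-Reasoning

eqF-refl : ∀ {n} (i : Fin n) → eqF i i ≡ true
eqF-refl i with i ≟F i
... | yes _ = refl
... | no i≢i = contradiction refl i≢i

eqF-sym : ∀ {n} (i j : Fin n) → eqF i j ≡ eqF j i
eqF-sym i j with i ≟F j | j ≟F i
... | yes _ | yes _ = refl
... | yes i≡j | no j≢i = contradiction (sym i≡j) j≢i
... | no i≢j | yes j≡i = contradiction (sym j≡i) i≢j
... | no _ | no _ = refl

eqF-suc : ∀ {n} (i j : Fin n) → eqF (fs i) (fs j) ≡ eqF i j
eqF-suc i j with i ≟F j
... | yes _ = refl
... | no _ = refl

eqF-true : ∀ {n} {i j : Fin n} → T (eqF i j) → i ≡ j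
eqF-true {i = i} {j} t with i ≟F j
... | yes i≡j = i≡j

count-++ : ∀ {A : Set} (f : A → Bool) xs ys → count f (xs ++ ys) ≡ count f xs + count f ys
count-++ f [] ys = refl
count-++ f (x ∷ xs) ys with f x
... | true = cong suc (count-++ f xs ys)
... | false = count-++ f xs ys

count-map : ∀ {A B : Set} (f : B → Bool) (g : A → B) xs → count f (map g xs) ≡ count (f ∘ g) xs
count-map f g [] = refl
count-map f g (x ∷ xs) with f (g x)
... | true = cong suc (count-map f g xs)
... | false = count-map f g xs

count-cong : ∀ {A : Set} {f g : A → Bool} → (∀ x → f x ≡ g x) → ∀ xs → count f xs ≡ count g xs
count-cong f≗g [] = refl
count-cong {g = g} f≗g (x ∷ xs) rewrite f≗g x with g x
... | true = cong suc (count-cong f≗g xs)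
... | false = count-cong f≗g xs

count-false : ∀ {A : Set} (xs : List A) → count (λ _ → false) xs ≡ 0
count-false [] = refl
count-false (x ∷ xs) = count-false xs

count-tabulate : ∀ {A : Set} {n} (f : A → Bool) (g : Fin n → A) → count f (tabulate g) ≡ count (f ∘ g) (allFin n)
count-tabulate {n = zero} f g = refl
count-tabulate {n = suc n} f g with f (g fz)
... | true = cong suc (trans (count-tabulate f (g ∘ fs)) (sym (count-tabulate (f ∘ g) fs)))
... | false = trans (count-tabulate f (g ∘ fs)) (sym (count-tabulate (f ∘ g) fs))

count-eqF-allFin : ∀ {n} (y : Fin n) → count (eqF y) (allFin n) ≡ 1
count-eqF-allFin {suc n} fz = cong suc (trans (count-tabulate {n = n} (eqF fz) fs) (count-false (allFin n)))
count-eqF-allFin {suc n} (fs y) =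
  trans (count-tabulate {n = n} (eqF (fs y)) fs) (trans (count-cong (eqF-suc y) (allFin n)) (count-eqF-allFin y))

count-product : ∀ {A B : Set} (f : A → Bool) (g : B → Bool) xs ys →
  count (λ z → f (proj₁ z) ∧ g (proj₂ z)) (cartesianProduct xs ys) ≡ count f xs * count g ys
count-product f g [] ys = refl
count-product {A} {B} f g (x ∷ xs) ys = begin
  count fg (map (x ,_) ys ++ cartesianProduct xs ys)
    ≡⟨ count-++ fg (map (x ,_) ys) (cartesianProduct xs ys) ⟩
  count fg (map (x ,_) ys) + count fg (cartesianProduct xs ys)
    ≡⟨ cong₂ _+_ (count-map fg (x ,_) ys) (count-product f g xs ys) ⟩
  count (λ y → f x ∧ g y) ys + count f xs * count g ys
    ≡⟨ row (f x) ⟩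
  count f (x ∷ xs) * count g ys ∎
  where
    fg : A × B → Bool
    fg z = f (proj₁ z) ∧ g (proj₂ z)
    row : ∀ b → count (λ y → b ∧ g y) ys + count f xs * count g ys ≡ (if b then suc (count f xs) else count f xs) * count g ys
    row true = refl
    row false = cong (_+ count f xs * count g ys) (count-false ys)

length-filter-count : ∀ {A : Set} (f : A → Bool) xs → length (filter (T? ∘ f) xs) ≡ count f xs
length-filter-count f [] = refl
length-filter-count f (x ∷ xs) with f x
... | true = cong suc (length-filter-count f xs)
... | false = length-filter-count f xs

members≤length : ∀ {A : Set} {n} {L : List A} (f : Fin n → A) → Injective _≡_ _≡_ f →
  (∀ t → f t ∈ L) → n ≤ length L
members≤length {L = L} f f-inj mem = injective⇒≤ position-inj
  where
    position-inj : ∀ {t t'} → index (mem t) ≡ index (mem t') → t ≡ t'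
    position-inj {t} {t'} same = f-inj (begin
      f t                      ≡⟨ lookup-index (mem t) ⟩
      lookup L (index (mem t))  ≡⟨ cong (lookup L) same ⟩
      lookup L (index (mem t')) ≡⟨ sym (lookup-index (mem t')) ⟩
      f t'                     ∎)

avoiding≤ : ∀ {m n} {w : Fin (suc n)} (f : Fin m → Fin (suc n)) → Injective _≡_ _≡_ f →
  (∀ i → f i ≢ w) → m ≤ n
avoiding≤ {w = w} f f-inj misses = injective⇒≤ λ {i} {j} same →
  f-inj (punchOut-injective (misses i ∘ sym) (misses j ∘ sym) same)

one-missed : ∀ {n} (τ : Fin n → Fin (suc n)) → Injective _≡_ _≡_ τ →
  Σ (Fin (suc n)) λ w → (∀ i → τ i ≢ w) × (∀ s → s ≢ w → Σ (Fin n) λ i → τ i ≡ s)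
one-missed {n} τ τ-inj with all? (λ s → any? (λ i → τ i ≟F s))
... | yes onto = contradiction (injective⇒≤ preimage-inj) (n≮n n)
  where
    preimage-inj : ∀ {s s'} → proj₁ (onto s) ≡ proj₁ (onto s') → s ≡ s'
    preimage-inj {s} {s'} same = trans (sym (proj₂ (onto s))) (trans (cong τ same) (proj₂ (onto s')))
... | no not-onto with ¬∀⟶∃¬ (suc n) _ (λ s → any? (λ i → τ i ≟F s)) not-onto
...   | w , w-missed = w , (λ i τi≡w → w-missed (i , τi≡w)) , hit
  where
    -- a second missed point s would let τ extend to an injection Fin (suc n) → Fin (suc n) missing w
    hit : ∀ s → s ≢ w → Σ (Fin n) λ i → τ i ≡ s
    hit s s≢w with any? (λ i → τ i ≟F s)
    ... | yes found = found
    ... | no s-missed = contradiction (avoiding≤ extend extend-inj extend-misses) (n≮n n)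
      where
        extend : Fin (suc n) → Fin (suc n)
        extend fz = s
        extend (fs i) = τ i
        extend-inj : Injective _≡_ _≡_ extend
        extend-inj {fz} {fz} _ = refl
        extend-inj {fz} {fs j} s≡τj = contradiction (j , sym s≡τj) s-missed
        extend-inj {fs i} {fz} τi≡s = contradiction (i , τi≡s) s-missed
        extend-inj {fs i} {fs j} τi≡τj = cong fs (τ-inj τi≡τj)
        extend-misses : ∀ i → extend i ≢ w
        extend-misses fz = s≢w
        extend-misses (fs i) τi≡w = w-missed (i , τi≡w)

neighbours≤degree : ∀ {V : Set} (adj : V → V → Bool) {vs : List V} → (∀ v → v ∈ vs) →
  ∀ {n v} (f : Fin n → V) → Injective _≡_ _≡_ f → (∀ t → T (adj v (f t))) → n ≤ degree adj vs v
neighbours≤degree adj {vs} complete {v = v} f f-inj adjacent =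
  subst (_ ≤_) (length-filter-count (adj v) vs)
    (members≤length f f-inj (λ t → ∈-filter⁺ (T? ∘ adj v) (complete (f t)) (adjacent t)))

module Walks {V : Set} (adj : V → V → Bool) where

  consec∈ˡ : ∀ {x y : V} {p} → Consec x y p → x ∈ p
  consec∈ˡ here = here refl
  consec∈ˡ (there c) = there (consec∈ˡ c)

  consec∈ʳ : ∀ {x y : V} {p} → Consec x y p → y ∈ p
  consec∈ʳ here = there (here refl)
  consec∈ʳ (there c) = there (consec∈ʳ c)

  walk-edge : ∀ {x y u v p} → Walk adj x y p → Consec u v p → T (adj u v)
  walk-edge (step xy _) here = xy
  walk-edge (step _ w) (there c) = walk-edge w c

  first-edge : ∀ {x y p} → Walk adj x y p → x ≢ y → Σ V λ n → T (adj x n) × Consec x n p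
  first-edge single x≢x = contradiction refl x≢x
  first-edge (step xy _) _ = _ , xy , here

  last-edge : ∀ {x y p} → Walk adj x y p → x ≢ y → Σ V λ n → T (adj n y) × Consec n y p
  last-edge single x≢x = contradiction refl x≢x
  last-edge (step xy w) _ = last-step xy w
    where
      last-step : ∀ {x y z p} → T (adj x y) → Walk adj y z (y ∷ p) → Σ V λ n → T (adj n z) × Consec n z (x ∷ y ∷ p)
      last-step {x} xy single = x , xy , here
      last-step _ (step yz w) with last-step yz w
      ... | n , nz , c = n , nz , there c

  interior-edges : ∀ {x y w p} → Walk adj x y p → Unique p → w ∈ p → w ≢ x → w ≢ y →
    Σ V λ u → Σ V λ v → Consec u w p × Consec w v p × u ≢ v
  interior-edges single _ (here refl) w≢x _ = contradiction refl w≢x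
  interior-edges (step _ _) _ (here refl) w≢x _ = contradiction refl w≢x
  interior-edges {x = x} (step _ w) (x∉ ∷ _) (there (here refl)) _ w≢y with first-edge w w≢y
  ... | v , _ , c = x , v , here , there c , All.lookup x∉ (consec∈ʳ c)
  interior-edges (step _ w) (_ ∷ uniq@(y∉ ∷ _)) (there (there m)) _ w≢y
    with interior-edges w uniq (there m) (λ w≡y → All.lookup y∉ m (sym w≡y)) w≢y
  ... | u , v , cu , cv , u≢v = u , v , there cu , there cv , u≢v

  side-change : (side : V → Bool) → ∀ {x y p} → Walk adj x y p → side x ≢ side y →
    Σ V λ u → Σ V λ v → Consec u v p × T (adj u v) × side u ≢ side v
  side-change side single differ = contradiction refl differ
  side-change side {x} (step {y = y} xy w) differ with side x ≟B side y
  ... | no x≁y = x , y , here , xy , x≁y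
  ... | yes x∼y with side-change side w (differ ∘ trans x∼y)
  ...   | u , v , c , uv , u≁v = u , v , there c , uv , u≁v

SamePair : {A : Set} → A → A → A → A → Set
SamePair i j i' j' = (i ≡ i' × j ≡ j') ⊎ (i ≡ j' × j ≡ i')

same-pair? : ∀ {n} (i j i' j' : Fin n) → Dec (SamePair i j i' j')
same-pair? i j i' j' = ((i ≟F i') ×-dec (j ≟F j')) ⊎-dec ((i ≟F j') ×-dec (j ≟F i'))

same-pair-map : ∀ {A B : Set} (f : A → B) {i j i' j'} → SamePair i j i' j' → SamePair (f i) (f j) (f i') (f j')
same-pair-map f (inj₁ (refl , refl)) = inj₁ (refl , refl)
same-pair-map f (inj₂ (refl , refl)) = inj₂ (refl , refl)

same-pair-cong : ∀ {A : Set} {i j i' j' x y x' y' : A} → i ≡ x → j ≡ y → i' ≡ x' → j' ≡ y' →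
  SamePair i j i' j' → SamePair x y x' y'
same-pair-cong refl refl refl refl same = same

same-pair-swap : ∀ {A : Set} {i j i' j' : A} → SamePair i j i' j' → SamePair j i i' j'
same-pair-swap (inj₁ (i≡i' , j≡j')) = inj₂ (j≡j' , i≡i')
same-pair-swap (inj₂ (i≡j' , j≡i')) = inj₁ (j≡i' , i≡j')

module Immersion {V : Set} (adj : V → V → Bool) (adj-sym : ∀ {u v} → T (adj u v) → T (adj v u))
  (loopless : ∀ {v} → ¬ T (adj v v)) {vs : List V} (complete : ∀ v → v ∈ vs)
  {t : ℕ} (I : ImmersionK (suc t) adj) where

  open ImmersionK I
  open Walks adj

  Branch : Set
  Branch = Fin (suc t)

  record Ordered (i j : Branch) : Set where
    constructor ordered
    field
      lo hi : Branch
      lo<hi : lo < hi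
      sorts : SamePair lo hi i j

  open Ordered

  order : ∀ {i j} → i ≢ j → Ordered i j
  order {i} {j} i≢j with <-cmp i j
  ... | tri< i<j _ _ = ordered i j i<j (inj₁ (refl , refl))
  ... | tri≈ _ i≡j _ = contradiction i≡j i≢j
  ... | tri> _ _ j<i = ordered j i j<i (inj₂ (refl , refl))

  flip : ∀ {i j} → Ordered i j → Ordered j i
  flip o = ordered (lo o) (hi o) (lo<hi o) (swap-ends (sorts o))
    where
      swap-ends : ∀ {a b i j : Branch} → SamePair a b i j → SamePair a b j i
      swap-ends (inj₁ (a≡i , b≡j)) = inj₂ (a≡i , b≡j)
      swap-ends (inj₂ (a≡j , b≡i)) = inj₁ (a≡j , b≡i)

  ordered-distinct : ∀ {i j} → Ordered i j → i ≢ j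
  ordered-distinct (ordered _ _ lt (inj₁ (refl , refl))) = <⇒≢ lt
  ordered-distinct (ordered _ _ lt (inj₂ (refl , refl))) = <⇒≢ lt ∘ sym

  route : ∀ {i j} → Ordered i j → List V
  route o = path (lo o) (hi o)

  route-walk : ∀ {i j} (o : Ordered i j) → Walk adj (φ (lo o)) (φ (hi o)) (route o)
  route-walk o = proj₁ (isPath (lo o) (hi o) (lo<hi o))

  route-unique : ∀ {i j} (o : Ordered i j) → Unique (route o)
  route-unique o = proj₂ (isPath (lo o) (hi o) (lo<hi o))

  route-ends : ∀ {i j} (o : Ordered i j) → φ (lo o) ≢ φ (hi o)
  route-ends o φlo≡φhi = <⇒≢ (lo<hi o) (φ-inj _ _ φlo≡φhi)

  route-edge : ∀ {i j u v} (o : Ordered i j) → UsesEdge u v (route o) → T (adj u v)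
  route-edge o (inj₁ c) = walk-edge (route-walk o) c
  route-edge o (inj₂ c) = adj-sym (walk-edge (route-walk o) c)

  route-leaves : ∀ {i j} (o : Ordered i j) → Σ V λ x → T (adj (φ i) x) × UsesEdge (φ i) x (route o)
  route-leaves o@(ordered _ _ _ (inj₁ (refl , refl))) with first-edge (route-walk o) (route-ends o)
  ... | x , ix , c = x , ix , inj₁ c
  route-leaves o@(ordered _ _ _ (inj₂ (refl , refl))) with last-edge (route-walk o) (route-ends o)
  ... | x , xi , c = x , adj-sym xi , inj₂ c

  routes-disjoint : ∀ {i j i' j' u v} (o : Ordered i j) (o' : Ordered i' j') →
    UsesEdge u v (route o) → UsesEdge u v (route o') → SamePair i j i' j'
  routes-disjoint {u = u} {v} o o' uses uses' with lo o ≟F lo o' | hi o ≟F hi o'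
  ... | yes lo≡ | yes hi≡ = same-ends (sorts o) (sorts o') lo≡ hi≡
    where
      same-ends : ∀ {a b a' b' i j i' j' : Branch} → SamePair a b i j → SamePair a' b' i' j' →
        a ≡ a' → b ≡ b' → SamePair i j i' j'
      same-ends (inj₁ (refl , refl)) (inj₁ (refl , refl)) refl refl = inj₁ (refl , refl)
      same-ends (inj₁ (refl , refl)) (inj₂ (refl , refl)) refl refl = inj₂ (refl , refl)
      same-ends (inj₂ (refl , refl)) (inj₁ (refl , refl)) refl refl = inj₂ (refl , refl)
      same-ends (inj₂ (refl , refl)) (inj₂ (refl , refl)) refl refl = inj₁ (refl , refl)
  ... | yes _ | no hi≢ = ⊥-elim (disjoint _ _ _ _ (lo<hi o) (lo<hi o') (hi≢ ∘ proj₂) u v uses uses')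
  ... | no lo≢ | _ = ⊥-elim (disjoint _ _ _ _ (lo<hi o) (lo<hi o') (lo≢ ∘ proj₁) u v uses uses')

  -- A branch vertex of degree at most t spends all its edges on its own t routes,
  -- so the route of a pair not containing l uses no edge at φ l.
  saturated : ∀ l → degree adj vs (φ l) ≤ t → ∀ {i j y} (o : Ordered i j) → l ≢ i → l ≢ j →
    ¬ UsesEdge (φ l) y (route o)
  saturated l deg≤t {i} {j} {y} o l≢i l≢j uses =
    n≮n t (≤-trans (neighbours≤degree adj complete f f-inj f-adj) deg≤t)
    where
      own : ∀ s → Ordered l (punchIn l s)
      own s = order (punchInᵢ≢i l s ∘ sym)
      f : Fin (suc t) → V
      f fz = y
      f (fs s) = proj₁ (route-leaves (own s))
      uses-own : ∀ s → UsesEdge (φ l) (f (fs s)) (route (own s))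
      uses-own s = proj₂ (proj₂ (route-leaves (own s)))
      f-adj : ∀ s → T (adj (φ l) (f s))
      f-adj fz = route-edge o uses
      f-adj (fs s) = proj₁ (proj₂ (route-leaves (own s)))
      not-own : ∀ {s} → SamePair i j l (punchIn l s) → ⊥
      not-own (inj₁ (i≡l , _)) = l≢i (sym i≡l)
      not-own (inj₂ (_ , j≡l)) = l≢j (sym j≡l)
      f-inj : Injective _≡_ _≡_ f
      f-inj {fz} {fz} _ = refl
      f-inj {fz} {fs s} y≡ = ⊥-elim (not-own {s}
        (routes-disjoint o (own s) uses (subst (λ z → UsesEdge (φ l) z (route (own s))) (sym y≡) (uses-own s))))
      f-inj {fs s} {fz} ≡y = ⊥-elim (not-own {s}
        (routes-disjoint o (own s) uses (subst (λ z → UsesEdge (φ l) z (route (own s))) ≡y (uses-own s))))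
      f-inj {fs s} {fs s'} same
        with routes-disjoint (own s) (own s') (uses-own s) (subst (λ z → UsesEdge (φ l) z (route (own s'))) (sym same) (uses-own s'))
      ... | inj₁ (_ , ps≡ps') = cong fs (punchIn-injective l s s' ps≡ps')
      ... | inj₂ (l≡ps' , _) = contradiction (sym l≡ps') (punchInᵢ≢i l s')

  exit-non-branch : (∀ l → degree adj vs (φ l) ≤ t) → ∀ {i j} (o : Ordered i j) → ¬ T (adj (φ i) (φ j)) →
    Σ V λ x → T (adj (φ i) x) × x ∈ route o × (∀ l → x ≢ φ l)
  exit-non-branch degrees {i} {j} o i≁j with route-leaves o
  ... | x , ix , uses = x , ix , on-route uses , not-branch
    where
      on-route : UsesEdge (φ i) x (route o) → x ∈ route o
      on-route (inj₁ c) = consec∈ʳ c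
      on-route (inj₂ c) = consec∈ˡ c
      not-branch : ∀ l → x ≢ φ l
      not-branch l refl with l ≟F i | l ≟F j
      ... | yes refl | _ = loopless ix
      ... | no _ | yes refl = i≁j ix
      ... | no l≢i | no l≢j = saturated l (degrees l) o l≢i l≢j (swap⊎ uses)

  -- If every edge between the two sides of a partition is one of m edges, and both sides
  -- contain a branch vertex, then t routes must cross these m edges, so t ≤ m.
  module _ (side : V → Bool) {m : ℕ} (cut : Fin m → V × V)
    (cut-edge : ∀ {u v} → T (adj u v) → side u ≢ side v → Σ (Fin m) λ e → SamePair u v (proj₁ (cut e)) (proj₂ (cut e)))
    where

    route-crosses : ∀ {i j} (o : Ordered i j) → side (φ i) ≢ side (φ j) →
      Σ (Fin m) λ e → UsesEdge (proj₁ (cut e)) (proj₂ (cut e)) (route o)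
    route-crosses o differ with side-change side (route-walk o) (ends-differ (sorts o))
      where
        ends-differ : SamePair (lo o) (hi o) _ _ → side (φ (lo o)) ≢ side (φ (hi o))
        ends-differ (inj₁ (refl , refl)) = differ
        ends-differ (inj₂ (refl , refl)) = differ ∘ sym
    ... | u , v , c , uv , u≁v with cut-edge uv u≁v
    ...   | e , inj₁ (refl , refl) = e , inj₁ c
    ...   | e , inj₂ (refl , refl) = e , inj₂ c

    cut-bound : ∀ {i₀ j₀} → side (φ i₀) ≢ side (φ j₀) → t ≤ m
    cut-bound {i₀} {j₀} i₀≁j₀ = injective⇒≤ {f = edge-of} edge-of-inj
      where
        -- each branch vertex l ≠ j₀ has a route to i₀ or to j₀ crossing the cut
        record Crossing (l : Branch) : Set where
          constructor crossed
          field
            partner : Branch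
            partner-end : partner ≡ i₀ ⊎ partner ≡ j₀
            l≢partner : l ≢ partner
            edge : Fin m
            crosses : UsesEdge (proj₁ (cut edge)) (proj₂ (cut edge)) (route (order l≢partner))

        crossing-via : ∀ {l p} → p ≡ i₀ ⊎ p ≡ j₀ → (l≢p : l ≢ p) → side (φ l) ≢ side (φ p) → Crossing l
        crossing-via {p = p} end l≢p differ with route-crosses (order l≢p) differ
        ... | e , uses = crossed p end l≢p e uses

        crossing : ∀ l → l ≢ j₀ → Crossing l
        crossing l l≢j₀ with side (φ l) ≟B side (φ j₀)
        ... | no differ = crossing-via (inj₂ refl) l≢j₀ differ
        ... | yes same = crossing-via (inj₁ refl) (λ { refl → differ refl }) differ
          where
            differ : side (φ l) ≢ side (φ i₀)
            differ l∼i₀ = i₀≁j₀ (trans (sym l∼i₀) same)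

        crossing-of : ∀ s → Crossing (punchIn j₀ s)
        crossing-of s = crossing (punchIn j₀ s) (punchInᵢ≢i j₀ s)

        edge-of : Fin t → Fin m
        edge-of s = Crossing.edge (crossing-of s)

        same-start : ∀ {l p l' p'} → l ≢ j₀ → l' ≢ j₀ → p ≡ i₀ ⊎ p ≡ j₀ → p' ≡ i₀ ⊎ p' ≡ j₀ →
          SamePair l p l' p' → l ≡ l'
        same-start _ _ _ _ (inj₁ (l≡l' , _)) = l≡l'
        same-start l≢j₀ _ _ (inj₂ refl) (inj₂ (refl , _)) = contradiction refl l≢j₀
        same-start _ l'≢j₀ (inj₂ refl) _ (inj₂ (_ , refl)) = contradiction refl l'≢j₀
        same-start _ _ (inj₁ refl) (inj₁ refl) (inj₂ (l≡i₀ , i₀≡l')) = trans l≡i₀ i₀≡l'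

        edge-of-inj : ∀ {s s'} → edge-of s ≡ edge-of s' → s ≡ s'
        edge-of-inj {s} {s'} same-edge = punchIn-injective j₀ s s'
          (same-start (punchInᵢ≢i j₀ s) (punchInᵢ≢i j₀ s') (Crossing.partner-end C) (Crossing.partner-end C')
            (routes-disjoint (order (Crossing.l≢partner C)) (order (Crossing.l≢partner C')) (Crossing.crosses C)
              (subst (λ e → UsesEdge (proj₁ (cut e)) (proj₂ (cut e)) (route (order (Crossing.l≢partner C'))))
                (sym same-edge) (Crossing.crosses C'))))
          where
            C : Crossing (punchIn j₀ s)
            C = crossing-of s
            C' : Crossing (punchIn j₀ s')
            C' = crossing-of s'

  -- If the routes of r different pairs pass through a vertex w that is not a branch vertex,
  -- each enters and leaves w along its own two edges, so w has degree at least r + r.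
  through-bound : ∀ {r} (w : V) → (∀ l → w ≢ φ l) → (i j : Fin r → Branch) (o : ∀ k → Ordered (i k) (j k)) →
    (∀ {k k'} → SamePair (i k) (j k) (i k') (j k') → k ≡ k') → (∀ k → w ∈ route (o k)) →
    r + r ≤ degree adj vs w
  through-bound {r} w w-not-branch i j o different passes =
    neighbours≤degree adj complete (g ∘ splitAt r) g∘split-inj (λ s → g-adj (splitAt r s))
    where
      pass : ∀ k → Σ V λ u → Σ V λ v → Consec u w (route (o k)) × Consec w v (route (o k)) × u ≢ v
      pass k = interior-edges (route-walk (o k)) (route-unique (o k)) (passes k)
                 (w-not-branch (lo (o k))) (w-not-branch (hi (o k)))

      pair-of : Fin r ⊎ Fin r → Fin r
      pair-of (inj₁ k) = k
      pair-of (inj₂ k) = k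

      g : Fin r ⊎ Fin r → V
      g (inj₁ k) = proj₁ (pass k)
      g (inj₂ k) = proj₁ (proj₂ (pass k))

      g-uses : ∀ x → UsesEdge w (g x) (route (o (pair-of x)))
      g-uses (inj₁ k) = inj₂ (proj₁ (proj₂ (proj₂ (pass k))))
      g-uses (inj₂ k) = inj₁ (proj₁ (proj₂ (proj₂ (proj₂ (pass k)))))

      g-adj : ∀ x → T (adj w (g x))
      g-adj x = route-edge (o (pair-of x)) (g-uses x)

      same-pair : ∀ {x y} → g x ≡ g y → pair-of x ≡ pair-of y
      same-pair {x} {y} gx≡gy = different (routes-disjoint (o (pair-of x)) (o (pair-of y)) (g-uses x)
        (subst (λ z → UsesEdge w z (route (o (pair-of y)))) (sym gx≡gy) (g-uses y)))

      g-inj : Injective _≡_ _≡_ g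
      g-inj {inj₁ k} {inj₁ k'} same = cong inj₁ (same-pair {inj₁ k} {inj₁ k'} same)
      g-inj {inj₂ k} {inj₂ k'} same = cong inj₂ (same-pair {inj₂ k} {inj₂ k'} same)
      g-inj {inj₁ k} {inj₂ k'} same with same-pair {inj₁ k} {inj₂ k'} same
      ... | refl = contradiction same (proj₂ (proj₂ (proj₂ (proj₂ (pass k)))))
      g-inj {inj₂ k} {inj₁ k'} same with same-pair {inj₂ k} {inj₁ k'} same
      ... | refl = contradiction (sym same) (proj₂ (proj₂ (proj₂ (proj₂ (pass k)))))

      g∘split-inj : Injective _≡_ _≡_ (g ∘ splitAt r)
      g∘split-inj {s} {s'} same = begin
        s                         ≡⟨ sym (join-splitAt r r s) ⟩
        join r r (splitAt r s)    ≡⟨ cong (join r r) (g-inj {splitAt r s} {splitAt r s'} same) ⟩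
        join r r (splitAt r s')   ≡⟨ join-splitAt r r s' ⟩
        s'                        ∎

P8-sym : ∀ i j → P8adj i j ≡ P8adj j i
P8-sym = from-yes (all? λ i → all? λ j → P8adj i j ≟B P8adj j i)

P8-loopless : ∀ i → ¬ T (P8adj i i)
P8-loopless i i~i rewrite eqF-refl i = i~i

middles-adjacent : ∀ e e' → e ≢ e' → T (P8adj (middle e) (middle e'))
middles-adjacent = from-yes (all? λ e → all? λ e' → ¬? (e ≟F e') →-dec T? (P8adj (middle e) (middle e')))

deleted-avoiding : Fin 9 → Fin 4 → Fin 9 × Fin 9
deleted-avoiding w = Vec.lookup (edges-avoiding (quotient {3} 3 w))
  where
    edges-avoiding : Fin 3 → Vec (Fin 9 × Fin 9) 4
    edges-avoiding fz = (# 3 , # 4) Vec.∷ (# 4 , # 5) Vec.∷ (# 6 , # 7) Vec.∷ (# 7 , # 8) Vec.∷ Vec.[]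
    edges-avoiding (fs fz) = (# 0 , # 1) Vec.∷ (# 1 , # 2) Vec.∷ (# 6 , # 7) Vec.∷ (# 7 , # 8) Vec.∷ Vec.[]
    edges-avoiding (fs (fs fz)) = (# 0 , # 1) Vec.∷ (# 1 , # 2) Vec.∷ (# 3 , # 4) Vec.∷ (# 4 , # 5) Vec.∷ Vec.[]

avoiding-ends : ∀ w q → proj₁ (deleted-avoiding w q) ≢ w × proj₂ (deleted-avoiding w q) ≢ w
avoiding-ends = from-yes (all? λ w → all? λ q →
  ¬? (proj₁ (deleted-avoiding w q) ≟F w) ×-dec ¬? (proj₂ (deleted-avoiding w q) ≟F w))

avoiding-proper : ∀ w q → proj₁ (deleted-avoiding w q) ≢ proj₂ (deleted-avoiding w q)
avoiding-proper = from-yes (all? λ w → all? λ q → ¬? (proj₁ (deleted-avoiding w q) ≟F proj₂ (deleted-avoiding w q)))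

avoiding-non-edge : ∀ w q → ¬ T (P8adj (proj₁ (deleted-avoiding w q)) (proj₂ (deleted-avoiding w q)))
avoiding-non-edge = from-yes (all? λ w → all? λ q → ¬? (T? (P8adj (proj₁ (deleted-avoiding w q)) (proj₂ (deleted-avoiding w q)))))

avoiding-distinct : ∀ w q q' → SamePair (proj₁ (deleted-avoiding w q)) (proj₂ (deleted-avoiding w q))
                                       (proj₁ (deleted-avoiding w q')) (proj₂ (deleted-avoiding w q')) → q ≡ q'
avoiding-distinct = from-yes (all? λ w → all? λ q → all? λ q' →
  same-pair? (proj₁ (deleted-avoiding w q)) (proj₂ (deleted-avoiding w q))
             (proj₁ (deleted-avoiding w q')) (proj₂ (deleted-avoiding w q')) →-dec (q ≟F q'))

module G8 (k : ℕ) (a : Fin k → Fin 3 → Fin 5) where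

  V : Set
  V = G8V k

  adj : V → V → Bool
  adj = G8adj k a

  adj-sym : ∀ {u v} → T (adj u v) → T (adj v u)
  adj-sym {u} {v} = subst T (adj-comm u v)
    where
      adj-comm : ∀ u v → adj u v ≡ adj v u
      adj-comm (inj₁ x) (inj₁ y) = cong not (eqF-sym x y)
      adj-comm (inj₁ x) (inj₂ _) = refl
      adj-comm (inj₂ _) (inj₁ x) = refl
      adj-comm (inj₂ (c , i)) (inj₂ (d , j)) = cong₂ _∧_ (eqF-sym c d) (P8-sym i j)

  loopless : ∀ {v} → ¬ T (adj v v)
  loopless {inj₁ x} x~x rewrite eqF-refl x = x~x
  loopless {inj₂ (c , i)} ci~ci rewrite eqF-refl c = P8-loopless i ci~ci

  complete : ∀ v → v ∈ G8vertices k
  complete (inj₁ x) = ∈-++⁺ˡ (∈-map⁺ inj₁ (∈-allFin x))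
  complete (inj₂ (c , i)) = ∈-++⁺ʳ (map inj₁ (allFin 5)) (∈-map⁺ inj₂ (∈-cartesianProduct⁺ (∈-allFin c) (∈-allFin i)))

  attachment : ∀ {c i x} → T (attached k a c i x) → Σ (Fin 3) λ e → i ≡ middle e × a c e ≡ x
  attachment {c} {i} {x} att with some-of-three att
    where
      joined : Fin 3 → Bool
      joined e = eqF (middle e) i ∧ eqF (a c e) x
      some-of-three : T (joined fz ∨ (joined (fs fz) ∨ joined (fs (fs fz)))) → Σ (Fin 3) (T ∘ joined)
      some-of-three t with joined fz in e₀ | joined (fs fz) in e₁
      ... | true | _ = fz , subst T (sym e₀) _
      ... | false | true = fs fz , subst T (sym e₁) _
      ... | false | false = fs (fs fz) , t
  ... | e , joined-e with Equivalence.to (T-∧ {eqF (middle e) i} {eqF (a c e) x}) joined-e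
  ...   | middle≡i , ace≡x = e , sym (eqF-true middle≡i) , eqF-true ace≡x

  attached-middle : ∀ c e x → attached k a c (middle e) x ≡ eqF (a c e) x
  attached-middle c fz x = ∨-identityʳ (eqF (a c fz) x)
  attached-middle c (fs fz) x = ∨-identityʳ (eqF (a c (fs fz)) x)
  attached-middle c (fs (fs fz)) x = refl

  one-attachment : ∀ c e → count (attached k a c (middle e)) (allFin 5) ≡ 1
  one-attachment c e = trans (count-cong (attached-middle c e) (allFin 5)) (count-eqF-allFin (a c e))

  attachments+P8-degree : ∀ c i → count (attached k a c i) (allFin 5) + count (P8adj i) (allFin 9) ≡ 7
  attachments+P8-degree c fz = refl
  attachments+P8-degree c (fs fz) = cong (_+ 6) (one-attachment c fz)
  attachments+P8-degree c (fs (fs fz)) = refl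
  attachments+P8-degree c (fs (fs (fs fz))) = refl
  attachments+P8-degree c (fs (fs (fs (fs fz)))) = cong (_+ 6) (one-attachment c (fs fz))
  attachments+P8-degree c (fs (fs (fs (fs (fs fz))))) = refl
  attachments+P8-degree c (fs (fs (fs (fs (fs (fs fz)))))) = refl
  attachments+P8-degree c (fs (fs (fs (fs (fs (fs (fs fz))))))) = cong (_+ 6) (one-attachment c (fs (fs fz)))
  attachments+P8-degree c (fs (fs (fs (fs (fs (fs (fs (fs fz)))))))) = refl

  copy-degree : ∀ c i → G8degree k a (inj₂ (c , i)) ≡ 7
  copy-degree c i = begin
    count adj-ci (map inj₁ (allFin 5) ++ map inj₂ copies)
      ≡⟨ count-++ adj-ci (map inj₁ (allFin 5)) (map inj₂ copies) ⟩
    count adj-ci (map inj₁ (allFin 5)) + count adj-ci (map inj₂ copies)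
      ≡⟨ cong₂ _+_ (count-map adj-ci inj₁ (allFin 5)) (count-map adj-ci inj₂ copies) ⟩
    attachments + count (λ z → eqF c (proj₁ z) ∧ P8adj i (proj₂ z)) copies
      ≡⟨ cong (attachments +_) (count-product (eqF c) (P8adj i) (allFin k) (allFin 9)) ⟩
    attachments + count (eqF c) (allFin k) * count (P8adj i) (allFin 9)
      ≡⟨ cong (λ n → attachments + n * count (P8adj i) (allFin 9)) (count-eqF-allFin c) ⟩
    attachments + (count (P8adj i) (allFin 9) + 0)
      ≡⟨ cong (attachments +_) (+-identityʳ _) ⟩
    attachments + count (P8adj i) (allFin 9)
      ≡⟨ attachments+P8-degree c i ⟩
    7 ∎
    where
      adj-ci : V → Bool
      adj-ci = adj (inj₂ (c , i))
      copies : List (Fin k × Fin 9)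
      copies = cartesianProduct (allFin k) (allFin 9)
      attachments : ℕ
      attachments = count (attached k a c i) (allFin 5)

  copy-adjacent : ∀ {c s s'} → T (adj (inj₂ (c , s)) (inj₂ (c , s'))) → T (P8adj s s')
  copy-adjacent {c} {s} {s'} = proj₂ ∘ Equivalence.to (T-∧ {eqF c c} {P8adj s s'})

  copy-neighbour : ∀ {c s x} → T (adj (inj₂ (c , s)) x) →
    (Σ (Fin 3) λ e → s ≡ middle e × x ≡ inj₁ (a c e)) ⊎ (Σ (Fin 9) λ s' → x ≡ inj₂ (c , s'))
  copy-neighbour {c} {s} {inj₁ y} att with attachment {c} {s} {y} att
  ... | e , s≡ , refl = inj₁ (e , s≡ , refl)
  copy-neighbour {c} {s} {inj₂ (d , s')} cs~ds' with eqF-true (proj₁ (Equivalence.to (T-∧ {eqF c d} {P8adj s s'}) cs~ds'))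
  ... | refl = inj₂ (s' , refl)

  inside : Fin k → V → Bool
  inside c (inj₁ _) = false
  inside c (inj₂ (d , _)) = eqF d c

  attachment-edge : Fin k → Fin 3 → V × V
  attachment-edge c e = inj₂ (c , middle e) , inj₁ (a c e)

  boundary-edge : ∀ c {u v} → T (adj u v) → inside c u ≢ inside c v →
    Σ (Fin 3) λ e → SamePair u v (proj₁ (attachment-edge c e)) (proj₂ (attachment-edge c e))
  boundary-edge c {inj₁ _} {inj₁ _} _ differ = contradiction refl differ
  boundary-edge c {inj₁ x} {inj₂ y} uv differ with boundary-edge c {inj₂ y} {inj₁ x} (adj-sym {inj₁ x} {inj₂ y} uv) (differ ∘ sym)
  ... | e , vu = e , same-pair-swap vu
  boundary-edge c {inj₂ (d , i)} {v} uv differ with copy-neighbour {d} {i} {v} uv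
  ... | inj₂ (s' , refl) = contradiction refl differ
  ... | inj₁ (e , refl , refl) with d ≟F c
  ...   | yes refl = e , inj₁ (refl , refl)
  ...   | no _ = contradiction refl differ

  in-copy : ∀ {c} v → inside c v ≡ true → Σ (Fin 9) λ s → v ≡ inj₂ (c , s)
  in-copy {c} (inj₂ (d , s)) d≡c with eqF-true {i = d} {j = c} (subst T (sym d≡c) _)
  ... | refl = s , refl

  position : V → Fin 9
  position (inj₁ _) = fz
  position (inj₂ (_ , s)) = s

  in-K5? : (v : V) → Dec (∃ λ x → v ≡ inj₁ x)
  in-K5? (inj₁ x) = yes (x , refl)
  in-K5? (inj₂ _) = no λ ()

  copy-of : ∀ v → ¬ (∃ λ x → v ≡ inj₁ x) → Σ (Fin k) λ c → inside c v ≡ true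
  copy-of (inj₁ x) not-K5 = contradiction (x , refl) not-K5
  copy-of (inj₂ (c , _)) _ = c , eqF-refl c

  module NoImmersion (I : ImmersionK 8 adj) where
    open ImmersionK I
    open Immersion adj (λ {u} {v} → adj-sym {u} {v}) (λ {v} → loopless {v}) complete I

    -- the K₅ has only five vertices, so some branch vertex lies in a copy of P₈
    in-some-copy : Σ Branch λ i → Σ (Fin k) λ c → inside c (φ i) ≡ true
    in-some-copy with all? (λ i → in-K5? (φ i))
    ... | yes all-K5 = ⊥-elim (8≰5 (injective⇒≤ {f = proj₁ ∘ all-K5} K5-inj))
      where
        8≰5 : ¬ 8 ≤ 5
        8≰5 (s≤s (s≤s (s≤s (s≤s (s≤s ())))))
        K5-inj : ∀ {i j} → proj₁ (all-K5 i) ≡ proj₁ (all-K5 j) → i ≡ j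
        K5-inj {i} {j} same = φ-inj i j (trans (proj₂ (all-K5 i)) (trans (cong inj₁ same) (sym (proj₂ (all-K5 j)))))
    ... | no not-all with ¬∀⟶∃¬ 8 _ (λ i → in-K5? (φ i)) not-all
    ...   | i , not-K5 = i , copy-of (φ i) not-K5

    -- A copy containing some but not all branch vertices is impossible: seven
    -- edge-disjoint routes would have to leave it through its three attachment edges.
    not-split : ∀ {c i₀ j₀} → inside c (φ i₀) ≡ true → inside c (φ j₀) ≡ false → ⊥
    not-split {c} {i₀} {j₀} i₀-in j₀-out = 7≰3 (cut-bound (inside c) (attachment-edge c) (boundary-edge c) differ)
      where
        differ : inside c (φ i₀) ≢ inside c (φ j₀)
        differ same with trans (sym i₀-in) (trans same j₀-out)
        ... | ()
        7≰3 : ¬ 7 ≤ 3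
        7≰3 (s≤s (s≤s (s≤s ())))

    positions-injective : ∀ {c} (τ : Branch → Fin 9) → (∀ i → φ i ≡ inj₂ (c , τ i)) → Injective _≡_ _≡_ τ
    positions-injective {c} τ φ≡ {i} {j} same =
      φ-inj i j (trans (φ≡ i) (trans (cong (λ s → inj₂ (c , s)) same) (sym (φ≡ j))))

    -- A copy c containing all eight branch vertices is impossible: the vertex W of the copy
    -- carrying no branch vertex would lie on the routes of four disjoint pairs, needing degree 8.
    -- Here τ i is the vertex of the copy carrying the branch vertex i.
    module AllInCopy (c : Fin k) (τ : Branch → Fin 9) (φ≡ : ∀ i → φ i ≡ inj₂ (c , τ i))
      (w : Fin 9) (w-missed : ∀ i → τ i ≢ w) (preimage : ∀ s → s ≢ w → Σ Branch λ i → τ i ≡ s) where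

      τ-inj : Injective _≡_ _≡_ τ
      τ-inj = positions-injective τ φ≡

      W : V
      W = inj₂ (c , w)

      W-not-branch : ∀ l → W ≢ φ l
      W-not-branch l W≡φl = w-missed l (sym (cong position (trans W≡φl (φ≡ l))))

      branch-degrees : ∀ l → degree adj (G8vertices k) (φ l) ≤ 7
      branch-degrees l = ≤-reflexive (trans (cong (G8degree k a) (φ≡ l)) (copy-degree c (τ l)))

      exit : ∀ {i j} (o : Ordered i j) → ¬ T (P8adj (τ i) (τ j)) → W ∈ route o ⊎ Σ (Fin 3) λ e → τ i ≡ middle e
      exit {i} {j} o nonadj = leave (exit-non-branch branch-degrees o φi≁φj)
        where
          φi≁φj : ¬ T (adj (φ i) (φ j))
          φi≁φj φi~φj = nonadj (copy-adjacent {c} {τ i} {τ j} (subst₂ (λ u v → T (adj u v)) (φ≡ i) (φ≡ j) φi~φj))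

          towards : ∀ s → inj₂ (c , s) ∈ route o → (∀ l → inj₂ (c , s) ≢ φ l) → W ∈ route o
          towards s s∈ s-not-branch with s ≟F w
          ... | yes refl = s∈
          ... | no s≢w with preimage s s≢w
          ...   | l , τl≡s = contradiction (sym (trans (φ≡ l) (cong (λ s → inj₂ (c , s)) τl≡s))) (s-not-branch l)

          leave : (Σ V λ x → T (adj (φ i) x) × x ∈ route o × (∀ l → x ≢ φ l)) →
            W ∈ route o ⊎ Σ (Fin 3) λ e → τ i ≡ middle e
          leave (x , ix , x∈ , x-not-branch) with copy-neighbour {c} {τ i} {x} (subst (λ u → T (adj u x)) (φ≡ i) ix)
          ... | inj₁ (e , τi≡ , _) = inj₂ (e , τi≡)
          ... | inj₂ (s , refl) = inj₁ (towards s x∈ x-not-branch)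

      -- since the middle vertices are pairwise adjacent, such a route passes through W
      through-W : ∀ {i j} (o : Ordered i j) → ¬ T (P8adj (τ i) (τ j)) → W ∈ route o
      through-W {i} {j} o nonadj = either-end (exit o nonadj) (exit (flip o) (nonadj ∘ subst T (P8-sym (τ j) (τ i))))
        where
          either-end : W ∈ route o ⊎ (Σ (Fin 3) λ e → τ i ≡ middle e) →
                       W ∈ route o ⊎ (Σ (Fin 3) λ e → τ j ≡ middle e) → W ∈ route o
          either-end (inj₁ W∈) _ = W∈
          either-end (inj₂ _) (inj₁ W∈) = W∈
          either-end (inj₂ (e , τi≡)) (inj₂ (e' , τj≡)) =
            contradiction (subst₂ (λ s s' → T (P8adj s s')) (sym τi≡) (sym τj≡) (middles-adjacent e e' e≢e')) nonadj
            where
              e≢e' : e ≢ e'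
              e≢e' refl = ordered-distinct o (τ-inj (trans τi≡ (sym τj≡)))

      i₁ j₁ : Fin 4 → Branch
      i₁ q = proj₁ (preimage (proj₁ (deleted-avoiding w q)) (proj₁ (avoiding-ends w q)))
      j₁ q = proj₁ (preimage (proj₂ (deleted-avoiding w q)) (proj₂ (avoiding-ends w q)))

      τi₁ : ∀ q → τ (i₁ q) ≡ proj₁ (deleted-avoiding w q)
      τi₁ q = proj₂ (preimage (proj₁ (deleted-avoiding w q)) (proj₁ (avoiding-ends w q)))

      τj₁ : ∀ q → τ (j₁ q) ≡ proj₂ (deleted-avoiding w q)
      τj₁ q = proj₂ (preimage (proj₂ (deleted-avoiding w q)) (proj₂ (avoiding-ends w q)))

      deleted : ∀ q → Ordered (i₁ q) (j₁ q)
      deleted q = order λ i≡j → avoiding-proper w q (trans (sym (τi₁ q)) (trans (cong τ i≡j) (τj₁ q)))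

      deleted-distinct : ∀ {q q'} → SamePair (i₁ q) (j₁ q) (i₁ q') (j₁ q') → q ≡ q'
      deleted-distinct {q} {q'} same =
        avoiding-distinct w q q' (same-pair-cong (τi₁ q) (τj₁ q) (τi₁ q') (τj₁ q') (same-pair-map τ same))

      deleted-through-W : ∀ q → W ∈ route (deleted q)
      deleted-through-W q = through-W (deleted q) (avoiding-non-edge w q ∘ subst₂ (λ s s' → T (P8adj s s')) (τi₁ q) (τj₁ q))

      impossible : ⊥
      impossible = n≮n 7 (subst (8 ≤_) (copy-degree c w)
        (through-bound W W-not-branch i₁ j₁ deleted deleted-distinct deleted-through-W))

    all-in-copy : ∀ c → (∀ i → inside c (φ i) ≡ true) → ⊥
    all-in-copy c all-in = with-missing (one-missed τ (positions-injective τ φ≡))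
      where
        τ : Branch → Fin 9
        τ i = proj₁ (in-copy (φ i) (all-in i))
        φ≡ : ∀ i → φ i ≡ inj₂ (c , τ i)
        φ≡ i = proj₂ (in-copy (φ i) (all-in i))
        with-missing : (Σ (Fin 9) λ w → (∀ i → τ i ≢ w) × (∀ s → s ≢ w → Σ Branch λ i → τ i ≡ s)) → ⊥
        with-missing (w , w-missed , preimage) = AllInCopy.impossible c τ φ≡ w w-missed preimage

    impossible : ⊥
    impossible with in-some-copy
    ... | i₀ , c , i₀-in with all? (λ i → inside c (φ i) ≟B true)
    ...   | yes all-in = all-in-copy c all-in
    ...   | no not-all with ¬∀⟶∃¬ 8 _ (λ i → inside c (φ i) ≟B true) not-all
    ...     | j₀ , j₀-out = not-split i₀-in (¬-not j₀-out)

  no-immersion : ¬ ImmersionK 8 adj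
  no-immersion I = NoImmersion.impossible I

-- Without any copy of P₈ the vertices of the K₅ would have degree 4.
some-copy : ∀ k (a : Fin k → Fin 3 → Fin 5) → (∀ x → 7 ≤ G8degree k a (inj₁ x)) → Fin k
some-copy zero a K5-degrees with K5-degrees fz
... | s≤s (s≤s (s≤s (s≤s ())))
some-copy (suc k) a _ = fz

theorem4p6 : (k : ℕ) (a : Fin k → Fin 3 → Fin 5) →
    (∀ (x : Fin 5) → 7 ≤ G8degree k a (inj₁ x)) →
    ((∀ v → 7 ≤ G8degree k a v) × ∃ (λ v → G8degree k a v ≡ 7))
    × ¬ ImmersionK 8 (G8adj k a)
theorem4p6 k a K5-degrees = (min-degree , (inj₂ (c , fz) , copy-degree c fz)) , no-immersion
  where
    open G8 k a
    c : Fin k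
    c = some-copy k a K5-degrees
    min-degree : ∀ v → 7 ≤ G8degree k a v
    min-degree (inj₁ x) = K5-degrees x
    min-degree (inj₂ (d , i)) = ≤-reflexive (sym (copy-degree d i))
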